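{- For any graph $G$, $\mathrm{th}_{\mathrm{H}}(G)=|V(G)|$ if and only if $G$ does not contain any of $2K_2$, $K_2\cup\overline{K_2}$, or $\overline{K_4}$ as an induced subgraph.
   Context: All graphs are finite, simple and undirected; $N(v)$ is the open neighborhood of $v$. $2K_2$ is the disjoint union of two edges, $K_2\cup\overline{K_2}$ is the disjoint union of an edge and two isolated vertices, and $\overline{K_4}$ is the edgeless graph on four vertices. Vertices are colored blue or white. Under the hopping color change rule, a blue vertex $v$ may force a white vertex $w$ (not necessarily adjacent to $v$) to become blue provided $v$ has not previously performed a force and every vertex of $N(v)$ is blue. Starting from an initial blue set $B\subseteq V(G)$, a chronological list of forces is a sequence of valid forces performed one at a time until no further force is possible; its unordered set of forces is a set of forces of $B$. $B$ is a hopping forcing set if some chronological list turns every vertex blue. For a set of forces $\mathcal F$ of $B$, put $\mathcal F^{(0)}=B$ and, for $t>0$, let $\mathcal F^{(t)}$ be the set of vertices $w$ for which there is a force $v\to w$ in $\mathcal F$ with $v\in\bigcup_{i<t}\mathcal F^{(i)}$ that is a valid hopping force when exactly the vertices of $\bigcup_{i<t}\mathcal F^{(i)}$ are blue. $\mathrm{pt}_{\mathrm{H}}(G;\mathcal F)$ is the least $t$ with $\bigcup_{i\le t}\mathcal F^{(i)}=V(G)$, and $\mathrm{pt}_{\mathrm{H}}(G;B)$ is the minimum of $\mathrm{pt}_{\mathrm{H}}(G;\mathcal F)$ over sets of forces $\mathcal F$ of $B$ ($\infty$ if $B$ is not a hopping forcing set). The hopping throttling number is $\mathrm{th}_{\mathrm{H}}(G)=\min_{B\subseteq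 V(G)}\big(|B|+\mathrm{pt}_{\mathrm{H}}(G;B)\big)$. -}

module Defs where

open import Data.Nat using (ℕ; zero; suc; _+_; _≤_)
open import Data.Bool using (Bool; true; false)
open import Data.Fin using (Fin) renaming (zero to f0; suc to fs)
open import Data.Fin.Subset using (Subset; _∈_; _∉_; ∣_∣; ⁅_⁆; _∪_; ⊥)
open import Data.List using (List; []; _∷_)
open import Data.List.Membership.Propositional using () renaming (_∈_ to _∈ₗ_)
open import Data.Product using (Σ; ∃; _×_; _,_)
open import Relation.Binary.PropositionalEquality using (_≡_)
open import Relation.Nullary using (¬_)
open import Function.Definitions using (Injective)

record Graph (n : ℕ) : Set where
  field
    adj   : Fin n → Fin n → Bool
    sym   : ∀ u v → adj u v ≡ adj v u
    irref : ∀ v → adj v v ≡ false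

open Graph public

Adj : ∀ {n} → Graph n → Fin n → Fin n → Set
Adj G v u = adj G v u ≡ true

Force : ℕ → Set
Force n = Fin n × Fin n

-- Validity of a hopping force v → w when the blue set is `blue`
-- and the vertices that have already forced are `used`.
record ValidForce {n} (G : Graph n) (blue used : Subset n) (v w : Fin n) : Set where
  constructor valid
  field
    v-blue   : v ∈ blue
    v-unused : v ∉ used
    w-white  : w ∉ blue
    nbrs     : ∀ u → Adj G v u → u ∈ blue

data Chrono {n} (G : Graph n) : Subset n → Subset n → List (Force n) → Set where
  done : ∀ {blue used} →
         (∀ v w → ¬ ValidForce G blue used v w) → Chrono G blue used []
  step : ∀ {blue used v w L} → ValidForce G blue used v w →
         Chrono G (⁅ w ⁆ ∪ blue) (⁅ v ⁆ ∪ used) L →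
         Chrono G blue used ((v , w) ∷ L)

-- F is (a list presentation of) a set of forces of B: the forces of some
-- chronological list starting from B (only membership in F is used below).
SetOfForces : ∀ {n} → Graph n → Subset n → List (Force n) → Set
SetOfForces G B F = Chrono G B ⊥ F

-- BlueBy G B F t w  :  w ∈ ⋃_{i ≤ t} F^(i)
data BlueBy {n} (G : Graph n) (B : Subset n) (F : List (Force n)) :
            ℕ → Fin n → Set where
  init   : ∀ {w} → w ∈ B → BlueBy G B F 0 w
  keep   : ∀ {t w} → BlueBy G B F t w → BlueBy G B F (suc t) w
  forced : ∀ {t v w} → (v , w) ∈ₗ F → BlueBy G B F t v →
           (∀ u → Adj G v u → BlueBy G B F t u) → BlueBy G B F (suc t) w

-- pt_H(G;B) ≤ t : some set of forces F of B has pt_H(G;F) ≤ t.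
PtLe : ∀ {n} → Graph n → Subset n → ℕ → Set
PtLe G B t = ∃ λ F → SetOfForces G B F × (∀ w → BlueBy G B F t w)

ThH≡ : ∀ {n} → Graph n → ℕ → Set
ThH≡ G k = (∃ λ B → ∃ λ t → PtLe G B t × ∣ B ∣ + t ≡ k)
         × (∀ B t → PtLe G B t → k ≤ ∣ B ∣ + t)

InducedSub : ∀ {m n} → Graph m → Graph n → Set
InducedSub {m} {n} H G =
  Σ (Fin m → Fin n) λ f → Injective _≡_ _≡_ f × (∀ i j → adj H i j ≡ adj G (f i) (f j))

adj2K2 : Fin 4 → Fin 4 → Bool
adj2K2 f0 (fs f0) = true
adj2K2 (fs f0) f0 = true
adj2K2 (fs (fs f0)) (fs (fs (fs f0))) = true
adj2K2 (fs (fs (fs f0))) (fs (fs f0)) = true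
adj2K2 _ _ = false

adjK2∪2K1 : Fin 4 → Fin 4 → Bool
adjK2∪2K1 f0 (fs f0) = true
adjK2∪2K1 (fs f0) f0 = true
adjK2∪2K1 _ _ = false

twoK2 : Graph 4
twoK2 = record { adj = adj2K2 ; sym = s ; irref = r }
  where
  s : ∀ u v → adj2K2 u v ≡ adj2K2 v u
  s f0 f0 = _≡_.refl
  s f0 (fs f0) = _≡_.refl
  s f0 (fs (fs f0)) = _≡_.refl
  s f0 (fs (fs (fs f0))) = _≡_.refl
  s (fs f0) f0 = _≡_.refl
  s (fs f0) (fs f0) = _≡_.refl
  s (fs f0) (fs (fs f0)) = _≡_.refl
  s (fs f0) (fs (fs (fs f0))) = _≡_.refl
  s (fs (fs f0)) f0 = _≡_.refl
  s (fs (fs f0)) (fs f0) = _≡_.refl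
  s (fs (fs f0)) (fs (fs f0)) = _≡_.refl
  s (fs (fs f0)) (fs (fs (fs f0))) = _≡_.refl
  s (fs (fs (fs f0))) f0 = _≡_.refl
  s (fs (fs (fs f0))) (fs f0) = _≡_.refl
  s (fs (fs (fs f0))) (fs (fs f0)) = _≡_.refl
  s (fs (fs (fs f0))) (fs (fs (fs f0))) = _≡_.refl
  r : ∀ v → adj2K2 v v ≡ false
  r f0 = _≡_.refl
  r (fs f0) = _≡_.refl
  r (fs (fs f0)) = _≡_.refl
  r (fs (fs (fs f0))) = _≡_.refl

K2∪2K1 : Graph 4
K2∪2K1 = record { adj = adjK2∪2K1 ; sym = s ; irref = r }
  where
  s : ∀ u v → adjK2∪2K1 u v ≡ adjK2∪2K1 v u
  s f0 f0 = _≡_.refl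
  s f0 (fs f0) = _≡_.refl
  s f0 (fs (fs _)) = _≡_.refl
  s (fs f0) f0 = _≡_.refl
  s (fs f0) (fs f0) = _≡_.refl
  s (fs f0) (fs (fs _)) = _≡_.refl
  s (fs (fs _)) f0 = _≡_.refl
  s (fs (fs _)) (fs f0) = _≡_.refl
  s (fs (fs _)) (fs (fs _)) = _≡_.refl
  r : ∀ v → adjK2∪2K1 v v ≡ false
  r f0 = _≡_.refl
  r (fs f0) = _≡_.refl
  r (fs (fs _)) = _≡_.refl

emptyK4 : Graph 4
emptyK4 = record { adj = λ _ _ → false ; sym = λ _ _ → _≡_.refl ; irref = λ _ → _≡_.refl }

-- Call four distinct vertices a, b, c, d separated if neither a nor b is
-- adjacent to c or d.  A graph has a separated quadruple exactly when it has
-- one of the three forbidden induced subgraphs; which one is decided by the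
-- edges ab and cd.  Given such a quadruple, V ∖ {c, d} turns everything blue
-- in one round through the hops a → c and b → d, so th_H(G) ≤ n − 1.
-- Conversely, if there is none, two forces that can fire in the same round
-- have the same target: both forcers are blue with all neighbours blue and
-- both targets are white, so different targets would form a separated
-- quadruple.  Thus every round adds at most one vertex, so
-- |B| + pt_H(G;B) ≥ n, and B = V(G) attains n.
module Submission where

open import Defs hiding (sym)
open import Data.Nat using (ℕ; zero; suc; _+_; _≤_; _<_; _∸_; z≤n; s≤s)
open import Data.Nat.Properties
  using (≤-reflexive; ≤-trans; n≤1+n; +-identityʳ; +-suc; +-mono-≤; +-monoʳ-≤; +-monoʳ-<;
         m∸n+n≡m; <⇒≱; module ≤-Reasoning)
open import Data.Bool using (true; false)
open import Data.Bool.Properties using (¬-not)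
import Data.Bool as Bool
open import Data.Fin using (Fin; zero; suc)
open import Data.Fin.Properties using (all?) renaming (_≟_ to _≟F_)
open import Data.Fin.Subset using (Subset; _∈_; _∉_; ∣_∣; ⁅_⁆; _∪_; ⊥; ⊤; ∁; inside; outside)
open import Data.Fin.Subset.Properties
  using (_∈?_; ∉⊥; ∈⊤; ∣⊥∣≡0; ∣⊤∣≡n; ∣⁅x⁆∣≡1; ∣∁p∣≡n∸∣p∣; ∣p∣≤n; x∈⁅x⁆; x≢y⇒x∉⁅y⁆;
         x∈p∪q⁺; x∈p∪q⁻; q⊆p∪q; x∉p⇒x∈∁p; x∈p⇒x∉∁p; p⊆q⇒∣p∣≤∣q∣; p⊂q⇒∣p∣<∣q∣)
open import Data.Vec using ([]; _∷_)
open import Data.List using (List; []; _∷_)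
open import Data.List.Membership.Propositional using (find; lose) renaming (_∈_ to _∈ₗ_)
open import Data.List.Relation.Unary.Any using (here; there; any?)
open import Data.Product using (∃; _×_; _,_; proj₁)
open import Data.Sum using (_⊎_; inj₁; inj₂; [_,_])
open import Function using (_∘_)
open import Function.Bundles using (_⇔_; mk⇔)
open import Function.Definitions using (Injective)
open import Relation.Binary.PropositionalEquality using (_≡_; _≢_; refl; sym; trans; cong; subst)
open import Relation.Nullary using (¬_; Dec; yes; no; contradiction)
open import Relation.Nullary.Decidable using (_×-dec_; _→-dec_; ¬?)

pattern i₀ = zero
pattern i₁ = suc zero
pattern i₂ = suc (suc zero)
pattern i₃ = suc (suc (suc zero))

∣p∪q∣≤∣p∣+∣q∣ : ∀ {n} (p q : Subset n) → ∣ p ∪ q ∣ ≤ ∣ p ∣ + ∣ q ∣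
∣p∪q∣≤∣p∣+∣q∣ [] [] = z≤n
∣p∪q∣≤∣p∣+∣q∣ (inside ∷ p) (inside ∷ q) =
  s≤s (≤-trans (∣p∪q∣≤∣p∣+∣q∣ p q) (+-monoʳ-≤ ∣ p ∣ (n≤1+n _)))
∣p∪q∣≤∣p∣+∣q∣ (inside ∷ p) (outside ∷ q) = s≤s (∣p∪q∣≤∣p∣+∣q∣ p q)
∣p∪q∣≤∣p∣+∣q∣ (outside ∷ p) (inside ∷ q) =
  ≤-trans (s≤s (∣p∪q∣≤∣p∣+∣q∣ p q)) (≤-reflexive (sym (+-suc ∣ p ∣ ∣ q ∣)))
∣p∪q∣≤∣p∣+∣q∣ (outside ∷ p) (outside ∷ q) = ∣p∪q∣≤∣p∣+∣q∣ p q

x∉p∪q : ∀ {n} {x : Fin n} {p q} → x ∉ p → x ∉ q → x ∉ p ∪ q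
x∉p∪q {p = p} {q} x∉p x∉q = [ x∉p , x∉q ] ∘ x∈p∪q⁻ p q

1<∣⁅x⁆∪⁅y⁆∣ : ∀ {n} {x y : Fin n} → x ≢ y → 1 < ∣ ⁅ x ⁆ ∪ ⁅ y ⁆ ∣
1<∣⁅x⁆∪⁅y⁆∣ {x = x} {y} x≢y =
  subst (_< ∣ ⁅ x ⁆ ∪ ⁅ y ⁆ ∣) (∣⁅x⁆∣≡1 y)
    (p⊂q⇒∣p∣<∣q∣ (q⊆p∪q ⁅ x ⁆ ⁅ y ⁆ , x , x∈p∪q⁺ (inj₁ (x∈⁅x⁆ x)) , x≢y⇒x∉⁅y⁆ x≢y))

∣∁p∣+1<n : ∀ {n} (p : Subset n) → 1 < ∣ p ∣ → ∣ ∁ p ∣ + 1 < n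
∣∁p∣+1<n {n} p 1<∣p∣ = begin-strict
  ∣ ∁ p ∣ + 1          ≡⟨ cong (_+ 1) (∣∁p∣≡n∸∣p∣ p) ⟩
  n ∸ ∣ p ∣ + 1        <⟨ +-monoʳ-< (n ∸ ∣ p ∣) 1<∣p∣ ⟩
  n ∸ ∣ p ∣ + ∣ p ∣    ≡⟨ m∸n+n≡m (∣p∣≤n p) ⟩
  n                    ∎
  where open ≤-Reasoning

record SeparatedPairs {n} (G : Graph n) (a b c d : Fin n) : Set where
  field
    a≢b : a ≢ b
    a≢c : a ≢ c
    a≢d : a ≢ d
    b≢c : b ≢ c
    b≢d : b ≢ d
    c≢d : c ≢ d
    a≁c : adj G a c ≡ false
    a≁d : adj G a d ≡ false
    b≁c : adj G b c ≡ false
    b≁d : adj G b d ≡ false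

open SeparatedPairs

SeparatedPairsFree : ∀ {n} → Graph n → Set
SeparatedPairsFree G = ∀ {a b c d} → ¬ SeparatedPairs G a b c d

separatedPairs-swap : ∀ {n} {G : Graph n} {a b c d} → SeparatedPairs G a b c d → SeparatedPairs G c d a b
separatedPairs-swap {G = G} {a} {b} {c} {d} P = record
  { a≢b = c≢d P ; a≢c = a≢c P ∘ sym ; a≢d = b≢c P ∘ sym
  ; b≢c = a≢d P ∘ sym ; b≢d = b≢d P ∘ sym ; c≢d = a≢b P
  ; a≁c = trans (Graph.sym G c a) (a≁c P) ; a≁d = trans (Graph.sym G c b) (b≁c P)
  ; b≁c = trans (Graph.sym G d a) (a≁d P) ; b≁d = trans (Graph.sym G d b) (b≁d P) }

separatedPairs-image : ∀ {m n} {H : Graph m} {G : Graph n} (emb : InducedSub H G) {i j k l} →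
                       let f = proj₁ emb in
                       SeparatedPairs H i j k l → SeparatedPairs G (f i) (f j) (f k) (f l)
separatedPairs-image (f , injective , adj≡) P = record
  { a≢b = a≢b P ∘ injective ; a≢c = a≢c P ∘ injective ; a≢d = a≢d P ∘ injective
  ; b≢c = b≢c P ∘ injective ; b≢d = b≢d P ∘ injective ; c≢d = c≢d P ∘ injective
  ; a≁c = trans (sym (adj≡ _ _)) (a≁c P) ; a≁d = trans (sym (adj≡ _ _)) (a≁d P)
  ; b≁c = trans (sym (adj≡ _ _)) (b≁c P) ; b≁d = trans (sym (adj≡ _ _)) (b≁d P) }

separatedPairs-Fin4 : (H : Graph 4) → adj H i₀ i₂ ≡ false → adj H i₀ i₃ ≡ false →
                      adj H i₁ i₂ ≡ false → adj H i₁ i₃ ≡ false → SeparatedPairs H i₀ i₁ i₂ i₃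
separatedPairs-Fin4 H a≁c a≁d b≁c b≁d = record
  { a≢b = λ () ; a≢c = λ () ; a≢d = λ () ; b≢c = λ () ; b≢d = λ () ; c≢d = λ ()
  ; a≁c = a≁c ; a≁d = a≁d ; b≁c = b≁c ; b≁d = b≁d }

quad : ∀ {n} → Fin n → Fin n → Fin n → Fin n → Fin 4 → Fin n
quad a b c d i₀ = a
quad a b c d i₁ = b
quad a b c d i₂ = c
quad a b c d i₃ = d

quad-injective : ∀ {n} {G : Graph n} {a b c d} → SeparatedPairs G a b c d → Injective _≡_ _≡_ (quad a b c d)
quad-injective P {i₀} {i₀} _ = refl
quad-injective P {i₀} {i₁} e = contradiction e (a≢b P)
quad-injective P {i₀} {i₂} e = contradiction e (a≢c P)
quad-injective P {i₀} {i₃} e = contradiction e (a≢d P)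
quad-injective P {i₁} {i₀} e = contradiction (sym e) (a≢b P)
quad-injective P {i₁} {i₁} _ = refl
quad-injective P {i₁} {i₂} e = contradiction e (b≢c P)
quad-injective P {i₁} {i₃} e = contradiction e (b≢d P)
quad-injective P {i₂} {i₀} e = contradiction (sym e) (a≢c P)
quad-injective P {i₂} {i₁} e = contradiction (sym e) (b≢c P)
quad-injective P {i₂} {i₂} _ = refl
quad-injective P {i₂} {i₃} e = contradiction e (c≢d P)
quad-injective P {i₃} {i₀} e = contradiction (sym e) (a≢d P)
quad-injective P {i₃} {i₁} e = contradiction (sym e) (b≢d P)
quad-injective P {i₃} {i₂} e = contradiction (sym e) (c≢d P)
quad-injective P {i₃} {i₃} _ = refl

module _ {n} {G : Graph n} (H : Graph 4) (H-sep : SeparatedPairs H i₀ i₁ i₂ i₃)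
         {a b c d} (P : SeparatedPairs G a b c d)
         (ab : adj H i₀ i₁ ≡ adj G a b) (cd : adj H i₂ i₃ ≡ adj G c d) where

  private
    nonadjacent : ∀ {i j x y} → adj H i j ≡ false → adj G x y ≡ false → adj H i j ≡ adj G x y
    nonadjacent p q = trans p (sym q)

    flipped : ∀ {i j x y} → adj H i j ≡ adj G x y → adj H j i ≡ adj G y x
    flipped {i} {j} {x} {y} p = trans (Graph.sym H j i) (trans p (Graph.sym G x y))

    adj-quad : ∀ i j → adj H i j ≡ adj G (quad a b c d i) (quad a b c d j)
    adj-quad i₀ i₀ = nonadjacent (irref H i₀) (irref G a)
    adj-quad i₀ i₁ = ab
    adj-quad i₀ i₂ = nonadjacent (a≁c H-sep) (a≁c P)
    adj-quad i₀ i₃ = nonadjacent (a≁d H-sep) (a≁d P)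
    adj-quad i₁ i₀ = flipped ab
    adj-quad i₁ i₁ = nonadjacent (irref H i₁) (irref G b)
    adj-quad i₁ i₂ = nonadjacent (b≁c H-sep) (b≁c P)
    adj-quad i₁ i₃ = nonadjacent (b≁d H-sep) (b≁d P)
    adj-quad i₂ i₀ = flipped (adj-quad i₀ i₂)
    adj-quad i₂ i₁ = flipped (adj-quad i₁ i₂)
    adj-quad i₂ i₂ = nonadjacent (irref H i₂) (irref G c)
    adj-quad i₂ i₃ = cd
    adj-quad i₃ i₀ = flipped (adj-quad i₀ i₃)
    adj-quad i₃ i₁ = flipped (adj-quad i₁ i₃)
    adj-quad i₃ i₂ = flipped cd
    adj-quad i₃ i₃ = nonadjacent (irref H i₃) (irref G d)

  separatedPairs⇒induced : InducedSub H G
  separatedPairs⇒induced = quad a b c d , quad-injective P , adj-quad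

separatedPairsFree⇒¬induced : ∀ {m n} {H : Graph m} {G : Graph n} → SeparatedPairsFree G →
                              ∀ {i j k l} → SeparatedPairs H i j k l → ¬ InducedSub H G
separatedPairsFree⇒¬induced free P emb = free (separatedPairs-image emb P)

twoK2-separated : SeparatedPairs twoK2 i₀ i₁ i₂ i₃
twoK2-separated = separatedPairs-Fin4 twoK2 refl refl refl refl

K2∪2K1-separated : SeparatedPairs K2∪2K1 i₀ i₁ i₂ i₃
K2∪2K1-separated = separatedPairs-Fin4 K2∪2K1 refl refl refl refl

emptyK4-separated : SeparatedPairs emptyK4 i₀ i₁ i₂ i₃
emptyK4-separated = separatedPairs-Fin4 emptyK4 refl refl refl refl

separatedPairs⇒forbidden : ∀ {n} {G : Graph n} {a b c d} → SeparatedPairs G a b c d →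
                           InducedSub twoK2 G ⊎ InducedSub K2∪2K1 G ⊎ InducedSub emptyK4 G
separatedPairs⇒forbidden {G = G} {a} {b} {c} {d} P with adj G a b in ab | adj G c d in cd
... | true  | true  = inj₁ (separatedPairs⇒induced twoK2 twoK2-separated P (sym ab) (sym cd))
... | true  | false = inj₂ (inj₁ (separatedPairs⇒induced K2∪2K1 K2∪2K1-separated P (sym ab) (sym cd)))
... | false | true  = inj₂ (inj₁ (separatedPairs⇒induced K2∪2K1 K2∪2K1-separated (separatedPairs-swap P) (sym cd) (sym ab)))
... | false | false = inj₂ (inj₂ (separatedPairs⇒induced emptyK4 emptyK4-separated P (sym ab) (sym cd)))

all-blue-attains-n : ∀ {n} (G : Graph n) → ∃ λ B → ∃ λ t → PtLe G B t × ∣ B ∣ + t ≡ n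
all-blue-attains-n {n} G =
  ⊤ , 0 , ([] , done (λ v w vf → ValidForce.w-white vf ∈⊤) , (λ w → init ∈⊤)) ,
  trans (+-identityʳ ∣ ⊤ {n} ∣) (∣⊤∣≡n n)

module _ {n} {G : Graph n} {a b c d} (P : SeparatedPairs G a b c d) where

  private
    B : Subset n
    B = ∁ (⁅ c ⁆ ∪ ⁅ d ⁆)

    ∈B : ∀ {u} → u ≢ c → u ≢ d → u ∈ B
    ∈B u≢c u≢d = x∉p⇒x∈∁p (x∉p∪q (x≢y⇒x∉⁅y⁆ u≢c) (x≢y⇒x∉⁅y⁆ u≢d))

    c∉B : c ∉ B
    c∉B = x∈p⇒x∉∁p (x∈p∪q⁺ (inj₁ (x∈⁅x⁆ c)))

    d∉B : d ∉ B
    d∉B = x∈p⇒x∉∁p (x∈p∪q⁺ (inj₂ (x∈⁅x⁆ d)))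

    B-or-c-or-d : ∀ w → w ∈ B ⊎ w ≡ c ⊎ w ≡ d
    B-or-c-or-d w with w ≟F c | w ≟F d
    ... | yes w≡c | _       = inj₂ (inj₁ w≡c)
    ... | no _    | yes w≡d = inj₂ (inj₂ w≡d)
    ... | no w≢c  | no w≢d  = inj₁ (∈B w≢c w≢d)

    neighbours∈B : ∀ {x} → adj G x c ≡ false → adj G x d ≡ false → ∀ u → Adj G x u → u ∈ B
    neighbours∈B x≁c x≁d u x~u = ∈B (λ { refl → ¬false≡true (trans (sym x≁c) x~u) })
                                    (λ { refl → ¬false≡true (trans (sym x≁d) x~u) })
      where
      ¬false≡true : ¬ false ≡ true
      ¬false≡true ()

    a∈B : a ∈ B
    a∈B = ∈B (a≢c P) (a≢d P)

    b∈B : b ∈ B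
    b∈B = ∈B (b≢c P) (b≢d P)

    hops : List (Force n)
    hops = (a , c) ∷ (b , d) ∷ []

    hops-chrono : SetOfForces G B hops
    hops-chrono =
      step (valid a∈B ∉⊥ c∉B (neighbours∈B (a≁c P) (a≁d P)))
        (step (valid (x∈p∪q⁺ (inj₂ b∈B))
                     (x∉p∪q (x≢y⇒x∉⁅y⁆ (a≢b P ∘ sym)) ∉⊥)
                     (x∉p∪q (x≢y⇒x∉⁅y⁆ (c≢d P ∘ sym)) d∉B)
                     (λ u b~u → x∈p∪q⁺ (inj₂ (neighbours∈B (b≁c P) (b≁d P) u b~u))))
          (done (λ v w vf → ValidForce.w-white vf (all-blue w))))
      where
      all-blue : ∀ w → w ∈ ⁅ d ⁆ ∪ (⁅ c ⁆ ∪ B)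
      all-blue w with B-or-c-or-d w
      ... | inj₁ w∈B         = x∈p∪q⁺ (inj₂ (x∈p∪q⁺ (inj₂ w∈B)))
      ... | inj₂ (inj₁ refl) = x∈p∪q⁺ (inj₂ (x∈p∪q⁺ (inj₁ (x∈⁅x⁆ c))))
      ... | inj₂ (inj₂ refl) = x∈p∪q⁺ (inj₁ (x∈⁅x⁆ d))

    hops-blue : ∀ w → BlueBy G B hops 1 w
    hops-blue w with B-or-c-or-d w
    ... | inj₁ w∈B         = keep (init w∈B)
    ... | inj₂ (inj₁ refl) = forced (here refl) (init a∈B) (λ u a~u → init (neighbours∈B (a≁c P) (a≁d P) u a~u))
    ... | inj₂ (inj₂ refl) = forced (there (here refl)) (init b∈B) (λ u b~u → init (neighbours∈B (b≁c P) (b≁d P) u b~u))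

  separatedPairs⇒th<n : ∃ λ B → PtLe G B 1 × ∣ B ∣ + 1 < n
  separatedPairs⇒th<n = B , (hops , hops-chrono , hops-blue) , ∣∁p∣+1<n (⁅ c ⁆ ∪ ⁅ d ⁆) (1<∣⁅x⁆∪⁅y⁆∣ (c≢d P))

th≡n⇒separatedPairsFree : ∀ {n} (G : Graph n) → ThH≡ G n → SeparatedPairsFree G
th≡n⇒separatedPairsFree G (_ , minimal) P with separatedPairs⇒th<n P
... | B , pt≤1 , small = <⇒≱ small (minimal B 1 pt≤1)

module _ {n} (G : Graph n) where

  forcer-unused : ∀ {blue used L v w} → Chrono G blue used L → (v , w) ∈ₗ L → v ∉ used
  forcer-unused (step vf _)  (here refl) = ValidForce.v-unused vf
  forcer-unused (step _ ch) (there m)   = forcer-unused ch m ∘ x∈p∪q⁺ ∘ inj₂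

  forces-functional : ∀ {blue used L v w₁ w₂} → Chrono G blue used L →
                      (v , w₁) ∈ₗ L → (v , w₂) ∈ₗ L → w₁ ≡ w₂
  forces-functional (step _ ch) (here refl) (here refl) = refl
  forces-functional (step _ ch) (here refl) (there m)   = contradiction (x∈p∪q⁺ (inj₁ (x∈⁅x⁆ _))) (forcer-unused ch m)
  forces-functional (step _ ch) (there m)   (here refl) = contradiction (x∈p∪q⁺ (inj₁ (x∈⁅x⁆ _))) (forcer-unused ch m)
  forces-functional (step _ ch) (there m)   (there m′)  = forces-functional ch m m′

  Ready : Subset n → Force n → Set
  Ready X (v , w) = v ∈ X × (∀ u → Adj G v u → u ∈ X) × w ∉ X

  ready? : ∀ X f → Dec (Ready X f)
  ready? X (v , w) = v ∈? X ×-dec all? (λ u → (adj G v u Bool.≟ true) →-dec (u ∈? X)) ×-dec ¬? (w ∈? X)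

  module _ (free : SeparatedPairsFree G) {B F} (forces : SetOfForces G B F) where

    ready-targets-equal : ∀ {X v w v′ w′} → (v , w) ∈ₗ F → (v′ , w′) ∈ₗ F →
                          Ready X (v , w) → Ready X (v′ , w′) → w ≡ w′
    ready-targets-equal {X} {v} {w} {v′} {w′} m m′ (v∈X , Nv⊆X , w∉X) (v′∈X , Nv′⊆X , w′∉X) with w ≟F w′
    ... | yes w≡w′ = w≡w′
    ... | no w≢w′  = contradiction P free
      where
      ≢-across : ∀ {x y} → x ∈ X → y ∉ X → x ≢ y
      ≢-across x∈X y∉X refl = y∉X x∈X

      ≁-across : ∀ {x y} → (∀ u → Adj G x u → u ∈ X) → y ∉ X → adj G x y ≡ false
      ≁-across Nx⊆X y∉X = ¬-not (y∉X ∘ Nx⊆X _)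

      P : SeparatedPairs G v v′ w w′
      P = record
        { a≢b = λ { refl → w≢w′ (forces-functional forces m m′) }
        ; a≢c = ≢-across v∈X w∉X ; a≢d = ≢-across v∈X w′∉X
        ; b≢c = ≢-across v′∈X w∉X ; b≢d = ≢-across v′∈X w′∉X ; c≢d = w≢w′
        ; a≁c = ≁-across Nv⊆X w∉X ; a≁d = ≁-across Nv⊆X w′∉X
        ; b≁c = ≁-across Nv′⊆X w∉X ; b≁d = ≁-across Nv′⊆X w′∉X }

    ready-targets-bounded : ∀ X → ∃ λ Y → ∣ Y ∣ ≤ 1 × (∀ {v w} → (v , w) ∈ₗ F → Ready X (v , w) → w ∈ Y)
    ready-targets-bounded X with any? (ready? X) F
    ... | no none = ⊥ , subst (_≤ 1) (sym (∣⊥∣≡0 n)) z≤n , λ m r → contradiction (lose m r) none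
    ... | yes some with find some
    ... | (v* , w*) , m* , r* =
      ⁅ w* ⁆ , ≤-reflexive (∣⁅x⁆∣≡1 w*) ,
      λ m r → subst (_∈ ⁅ w* ⁆) (sym (ready-targets-equal m m* r r*)) (x∈⁅x⁆ w*)

    blueBy-cover : ∀ t → ∃ λ X → (∀ w → BlueBy G B F t w → w ∈ X) × ∣ X ∣ ≤ ∣ B ∣ + t
    blueBy-cover zero = B , (λ { w (init w∈B) → w∈B }) , ≤-reflexive (sym (+-identityʳ ∣ B ∣))
    blueBy-cover (suc t) with blueBy-cover t
    ... | X , covers , ∣X∣≤ with ready-targets-bounded X
    ... | Y , ∣Y∣≤1 , targets∈Y = Y ∪ X , covers′ , ∣Y∪X∣≤
      where
      covers′ : ∀ w → BlueBy G B F (suc t) w → w ∈ Y ∪ X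
      covers′ w (keep blue) = x∈p∪q⁺ (inj₂ (covers w blue))
      covers′ w (forced {v = v} m v-blue Nv-blue) with w ∈? X
      ... | yes w∈X = x∈p∪q⁺ (inj₂ w∈X)
      ... | no w∉X  = x∈p∪q⁺ (inj₁ (targets∈Y m (covers v v-blue , (λ u v~u → covers u (Nv-blue u v~u)) , w∉X)))

      ∣Y∪X∣≤ : ∣ Y ∪ X ∣ ≤ ∣ B ∣ + suc t
      ∣Y∪X∣≤ = begin
        ∣ Y ∪ X ∣         ≤⟨ ∣p∪q∣≤∣p∣+∣q∣ Y X ⟩
        ∣ Y ∣ + ∣ X ∣     ≤⟨ +-mono-≤ ∣Y∣≤1 ∣X∣≤ ⟩
        suc (∣ B ∣ + t)   ≡⟨ +-suc ∣ B ∣ t ⟨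
        ∣ B ∣ + suc t     ∎
        where open ≤-Reasoning

  separatedPairsFree⇒n≤ : SeparatedPairsFree G → ∀ B t → PtLe G B t → n ≤ ∣ B ∣ + t
  separatedPairsFree⇒n≤ free B t (F , forces , all-blue) with blueBy-cover free forces t
  ... | X , covers , ∣X∣≤ = begin
    n       ≡⟨ ∣⊤∣≡n n ⟨
    ∣ ⊤ {n} ∣ ≤⟨ p⊆q⇒∣p∣≤∣q∣ {p = ⊤} {q = X} (λ {w} _ → covers w (all-blue w)) ⟩
    ∣ X ∣   ≤⟨ ∣X∣≤ ⟩
    ∣ B ∣ + t ∎
    where open ≤-Reasoning

theorem3p18 : (n : ℕ) (G : Graph n) →
    ThH≡ G n ⇔ (¬ InducedSub twoK2 G × ¬ InducedSub K2∪2K1 G × ¬ InducedSub emptyK4 G)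
theorem3p18 n G = mk⇔
  (λ th → let free = th≡n⇒separatedPairsFree G th in
            separatedPairsFree⇒¬induced free twoK2-separated
          , separatedPairsFree⇒¬induced free K2∪2K1-separated
          , separatedPairsFree⇒¬induced free emptyK4-separated)
  (λ (no-2K2 , no-K2∪2K1 , no-K̄4) →
       all-blue-attains-n G
     , separatedPairsFree⇒n≤ G ([ no-2K2 , [ no-K2∪2K1 , no-K̄4 ] ] ∘ separatedPairs⇒forbidden))
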